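{- Let $(A,\sqcup,\underline{\phantom{a}}[\underline{\phantom{a}}])$ be an algebra satisfying: $\sqcup$ is associative and idempotent; $x=x[x\sqcup y]$; $x\sqcup y=y[x]\sqcup x$; $x[y][z]=x[z\sqcup y]$; $(x\sqcup y)[z]=x[z]\sqcup y[z]$; $x[y[x[z]]]=x[y[x][z]]$; $w[x[y[w[z]]]]=w[x[y[w][z]]]$. Let $n\ge2$ and $x_1,\dots,x_n,u\in A$ with $x_i[x_{i+1}]=x_i$ for all $1\le i\le n-1$. Then $(\eta_n)$: $x_1[x_2[x_3[\dots[x_n[u]]\dots]]]=x_1[x_2[x_3[\dots[x_n[x_1[u]]]\dots]]]$, and $(\eta_n')$: $x_1[x_2[x_3[\dots[x_n[u]]\dots]]]=x_1[(x_2[x_1])[(x_3[x_1])[\dots[(x_n[x_1])[u]]\dots]]]$.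
   Context: Convention: $u[v][w]$ means $(u[v])[w]$; the operations are abstract binary operations on the set $A$. In the displayed terms the brackets are nested to the right, e.g. $x_1[x_2[x_3[u]]]$ means $x_1[(x_2[(x_3[u])])]$. -}

module Defs where

open import Level using (Level)
open import Data.Nat using (ℕ; zero; suc)
open import Data.Fin using (Fin) renaming (zero to fzero; suc to fsuc)
open import Relation.Binary.PropositionalEquality using (_≡_)

record Alg (a : Level) : Set (Level.suc a) where
  infixl 7 _[_]
  infixr 6 _⊔_
  field
    Carrier : Set a
    _⊔_ : Carrier → Carrier → Carrier
    _[_] : Carrier → Carrier → Carrier
    ⊔-assoc : ∀ x y z → (x ⊔ y) ⊔ z ≡ x ⊔ (y ⊔ z)
    ⊔-idem  : ∀ x → x ⊔ x ≡ x
    ax1 : ∀ x y → x ≡ x [ x ⊔ y ]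
    ax2 : ∀ x y → x ⊔ y ≡ y [ x ] ⊔ x
    ax3 : ∀ x y z → x [ y ] [ z ] ≡ x [ z ⊔ y ]
    ax4 : ∀ x y z → (x ⊔ y) [ z ] ≡ x [ z ] ⊔ y [ z ]
    ax5 : ∀ x y z → x [ y [ x [ z ] ] ] ≡ x [ y [ x ] [ z ] ]
    ax6 : ∀ w x y z → w [ x [ y [ w [ z ] ] ] ] ≡ w [ x [ y [ w ] [ z ] ] ]

module _ {a : Level} (𝔸 : Alg a) where
  open Alg 𝔸

  nest : (n : ℕ) → (Fin n → Carrier) → Carrier → Carrier
  nest zero    f u = u
  nest (suc n) f u = f fzero [ nest n (λ i → f (fsuc i)) u ]

module Submission where

-- Call f₀[f₁[…[fₖ[u]]…]] a chain nest when fᵢ[fᵢ₊₁] = fᵢ for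
-- all consecutive indices.  Inside a chain nest of length ≥ 2 three facts are
-- proved together by induction on the length:
--   (η)  the head may be re-applied:     P(f₀[u])           = P(u),
--   (J)  joins with the head vanish:     P((u ⊔ f₀) ⊔ w)    = P(u)   (length ≥ 1),
--   (H)  applying the head is joining:   P(f₀[z])           = P(z ⊔ f₀).
-- (η) follows from (H) and (J) for the tail, while (J) and (H) at length k+1
-- use (η) at length k; (H) peels the last element with a "snoc" view of nests
-- and uses axiom ax5.
-- (η) is the first claim.  For the second, (η) and (H) give P(v ⊔ f₀) = P(v),
-- so the last element fₙ[v] can be replaced by fₙ[v ⊔ f₀] = fₙ[f₀][v]; repeating
-- this from the inside out relativizes every fᵢ (i ≥ 1) to fᵢ[f₀].
-- Chains are indexed by Fin, where inject₁ and fsuc commute definitionally, so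
-- the initial and final segments of a chain are chains without reindexing.

open import Defs
open import Level using (Level)
open import Function using (_∘_)
open import Data.Nat using (ℕ; zero; suc)
open import Data.Fin using (Fin; inject₁; fromℕ) renaming (zero to fzero; suc to fsuc)
open import Data.Product using (_×_; _,_)
open import Relation.Binary.PropositionalEquality using (_≡_; refl; sym; trans; cong; module ≡-Reasoning)

module ChainNests {a : Level} (𝔸 : Alg a) where
  open Alg 𝔸
  open ≡-Reasoning

  join-right : ∀ {x y} → x [ y ] ≡ x → ∀ u → x [ u ] ≡ x [ u ⊔ y ]
  join-right {x} {y} xy u = begin
    x [ u ]         ≡⟨ cong (_[ u ]) (sym xy) ⟩
    x [ y ] [ u ]   ≡⟨ ax3 x y u ⟩
    x [ u ⊔ y ]     ∎

  self-absorb : ∀ x u w → x [ (u ⊔ x) ⊔ w ] ≡ x [ u ]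
  self-absorb x u w = begin
    x [ (u ⊔ x) ⊔ w ]   ≡⟨ cong (x [_]) (⊔-assoc u x w) ⟩
    x [ u ⊔ (x ⊔ w) ]   ≡⟨ sym (ax3 x (x ⊔ w) u) ⟩
    x [ x ⊔ w ] [ u ]   ≡⟨ cong (_[ u ]) (sym (ax1 x w)) ⟩
    x [ u ]             ∎

  ax5-join : ∀ x y z → x [ y [ x [ z ] ] ] ≡ x [ y [ z ⊔ x ] ]
  ax5-join x y z = trans (ax5 x y z) (cong (x [_]) (ax3 y x z))

  Chain : (n : ℕ) → (Fin (suc n) → Carrier) → Set a
  Chain n f = ∀ (i : Fin n) → f (inject₁ i) [ f (fsuc i) ] ≡ f (inject₁ i)

  init-chain : ∀ {n} (f : Fin (suc (suc n)) → Carrier) → Chain (suc n) f → Chain n (f ∘ inject₁)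
  init-chain f c i = c (inject₁ i)

  tail-chain : ∀ {n} (f : Fin (suc (suc n)) → Carrier) → Chain (suc n) f → Chain n (f ∘ fsuc)
  tail-chain f c i = c (fsuc i)

  nest-snoc : ∀ n (f : Fin (suc n) → Carrier) v →
              nest 𝔸 (suc n) f v ≡ nest 𝔸 n (f ∘ inject₁) (f (fromℕ n) [ v ])
  nest-snoc zero    f v = refl
  nest-snoc (suc n) f v = cong (f fzero [_]) (nest-snoc n (f ∘ fsuc) v)

  mutual
    head-reapply : ∀ k (f : Fin (suc (suc k)) → Carrier) → Chain (suc k) f → ∀ u →
                   nest 𝔸 (suc (suc k)) f (f fzero [ u ]) ≡ nest 𝔸 (suc (suc k)) f u
    head-reapply k f c u = begin
      P (f₀ [ u ])               ≡⟨ cong P (join-right (c fzero) u) ⟩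
      P (f₀ [ u ⊔ f₁ ])          ≡⟨ head-apply-join k f c (u ⊔ f₁) ⟩
      P ((u ⊔ f₁) ⊔ f₀)          ≡⟨ cong (f₀ [_]) (join-absorb k (f ∘ fsuc) (tail-chain f c) u f₀) ⟩
      P u                        ∎
      where
        P = nest 𝔸 (suc (suc k)) f
        f₀ = f fzero
        f₁ = f (fsuc fzero)

    join-absorb : ∀ k (g : Fin (suc k) → Carrier) → Chain k g → ∀ u w →
                  nest 𝔸 (suc k) g ((u ⊔ g fzero) ⊔ w) ≡ nest 𝔸 (suc k) g u
    join-absorb zero    g c u w = self-absorb (g fzero) u w
    join-absorb (suc k) g c u w = begin
      P ((u ⊔ g₀) ⊔ w)           ≡⟨ sym (head-reapply k g c _) ⟩
      P (g₀ [ (u ⊔ g₀) ⊔ w ])    ≡⟨ cong P (self-absorb g₀ u w) ⟩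
      P (g₀ [ u ])               ≡⟨ head-reapply k g c u ⟩
      P u                        ∎
      where
        P = nest 𝔸 (suc (suc k)) g
        g₀ = g fzero

    head-apply-join : ∀ k (f : Fin (suc (suc k)) → Carrier) → Chain (suc k) f → ∀ z →
                      nest 𝔸 (suc (suc k)) f (f fzero [ z ]) ≡ nest 𝔸 (suc (suc k)) f (z ⊔ f fzero)
    head-apply-join zero    f c z = ax5-join (f fzero) (f (fsuc fzero)) z
    head-apply-join (suc k) f c z = begin
      nest 𝔸 (suc K) f (f₀ [ z ])   ≡⟨ nest-snoc K f _ ⟩
      P (y [ f₀ [ z ] ])             ≡⟨ sym (head-reapply k (f ∘ inject₁) (init-chain f c) _) ⟩
      P (f₀ [ y [ f₀ [ z ] ] ])      ≡⟨ cong P (ax5-join f₀ y z) ⟩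
      P (f₀ [ y [ z ⊔ f₀ ] ])        ≡⟨ head-reapply k (f ∘ inject₁) (init-chain f c) _ ⟩
      P (y [ z ⊔ f₀ ])               ≡⟨ sym (nest-snoc K f _) ⟩
      nest 𝔸 (suc K) f (z ⊔ f₀)     ∎
      where
        K = suc (suc k)
        P = nest 𝔸 K (f ∘ inject₁)
        f₀ = f fzero
        y = f (fromℕ K)

  head-join : ∀ k (f : Fin (suc (suc k)) → Carrier) → Chain (suc k) f → ∀ v →
              nest 𝔸 (suc (suc k)) f (v ⊔ f fzero) ≡ nest 𝔸 (suc (suc k)) f v
  head-join k f c v = trans (sym (head-apply-join k f c v)) (head-reapply k f c v)

  relativize-last : ∀ k (f : Fin (suc (suc k)) → Carrier) → Chain (suc k) f → ∀ w →
                    nest 𝔸 (suc (suc k)) f w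
                      ≡ nest 𝔸 (suc k) (f ∘ inject₁) (f (fromℕ (suc k)) [ f fzero ] [ w ])
  relativize-last k f c w = begin
    nest 𝔸 (suc (suc k)) f w                         ≡⟨ sym (head-join k f c w) ⟩
    nest 𝔸 (suc (suc k)) f (w ⊔ f fzero)             ≡⟨ nest-snoc (suc k) f _ ⟩
    nest 𝔸 (suc k) (f ∘ inject₁) (y [ w ⊔ f fzero ]) ≡⟨ cong (nest 𝔸 (suc k) (f ∘ inject₁)) (sym (ax3 y (f fzero) w)) ⟩
    nest 𝔸 (suc k) (f ∘ inject₁) (y [ f fzero ] [ w ]) ∎
    where y = f (fromℕ (suc k))

  relativize : ∀ n (f : Fin (suc n) → Carrier) → Chain n f → ∀ u →
               nest 𝔸 (suc n) f u ≡ f fzero [ nest 𝔸 n (λ i → f (fsuc i) [ f fzero ]) u ]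
  relativize zero    f c u = refl
  relativize (suc n) f c u = begin
    nest 𝔸 (suc (suc n)) f u                               ≡⟨ relativize-last n f c u ⟩
    nest 𝔸 (suc n) (f ∘ inject₁) (g (fromℕ n) [ u ])      ≡⟨ relativize n (f ∘ inject₁) (init-chain f c) _ ⟩
    f fzero [ nest 𝔸 n (g ∘ inject₁) (g (fromℕ n) [ u ]) ] ≡⟨ cong (f fzero [_]) (sym (nest-snoc n g u)) ⟩
    f fzero [ nest 𝔸 (suc n) g u ]                         ∎
    where
      g : Fin (suc n) → Carrier
      g i = f (fsuc i) [ f fzero ]

open ChainNests using (head-reapply; relativize)

lemma5p6 : ∀ {a : Level} (𝔸 : Alg a) (m : ℕ)
    (x : Fin (suc (suc m)) → Alg.Carrier 𝔸) (u : Alg.Carrier 𝔸) →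
    (∀ (i : Fin (suc m)) → Alg._[_] 𝔸 (x (inject₁ i)) (x (fsuc i)) ≡ x (inject₁ i)) →
    (nest 𝔸 (suc (suc m)) x u ≡ nest 𝔸 (suc (suc m)) x (Alg._[_] 𝔸 (x fzero) u))
    × (nest 𝔸 (suc (suc m)) x u
        ≡ Alg._[_] 𝔸 (x fzero) (nest 𝔸 (suc m) (λ i → Alg._[_] 𝔸 (x (fsuc i)) (x fzero)) u))
lemma5p6 𝔸 m x u chain = sym (head-reapply 𝔸 m x chain u) , relativize 𝔸 (suc m) x chain u
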